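{- Let $M$ be a standard multigraph, let $v_1,v_2,v_3$ be vertices spanning a $5$-triangle $T$ (pairwise adjacent with total multiplicity $5$), and let $e_1=a_1b_1$ and $e_2=a_2b_2$ be heavy edges with $a_1,b_1,a_2,b_2$ four distinct vertices outside $\{v_1,v_2,v_3\}$, such that $\|e_1,T\|\ge9$ and $\|e_2,T\|\ge7$, where $\|e_j,T\|=\sum_{i=1}^3(\mu(a_j,v_i)+\mu(b_j,v_i))$. Then the seven vertices $\{a_1,b_1,a_2,b_2,v_1,v_2,v_3\}$ contain two disjoint triples, each spanning a $5$-triangle (pairwise adjacent with total multiplicity at least $5$).
   Context: Multigraphs have no loops; $\mu(x,y)$ is the number of edges with ends $x,y$; $M$ is standard if $\mu(x,y)\le2$ for all $x,y$. An edge $xy$ is heavy if $\mu(x,y)=2$. A $5$-triangle is a multigraph on three vertices containing a triangle $C_3$ and having $5$ edges counted with multiplicity. -}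

module Defs where

open import Data.Nat using (ℕ; _+_; _≤_; _≥_)
open import Data.Fin using (Fin)
open import Data.Product using (_×_)
open import Relation.Binary.PropositionalEquality using (_≡_)

record Multigraph (n : ℕ) : Set where
  field
    μ        : Fin n → Fin n → ℕ
    μ-sym    : ∀ x y → μ x y ≡ μ y x
    loopless : ∀ x → μ x x ≡ 0

open Multigraph public

Standard : ∀ {n} → Multigraph n → Set
Standard M = ∀ x y → μ M x y ≤ 2

Heavy : ∀ {n} → Multigraph n → Fin n → Fin n → Set
Heavy M x y = μ M x y ≡ 2

Adjacent : ∀ {n} → Multigraph n → Fin n → Fin n → Set
Adjacent M x y = 1 ≤ μ M x y

PairwiseAdjacent : ∀ {n} → Multigraph n → Fin n → Fin n → Fin n → Set
PairwiseAdjacent M x y z = Adjacent M x y × Adjacent M y z × Adjacent M x z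

triWeight : ∀ {n} → Multigraph n → Fin n → Fin n → Fin n → ℕ
triWeight M x y z = μ M x y + μ M y z + μ M x z

Is5Triangle : ∀ {n} → Multigraph n → Fin n → Fin n → Fin n → Set
Is5Triangle M x y z = PairwiseAdjacent M x y z × triWeight M x y z ≡ 5

Spans5Triangle : ∀ {n} → Multigraph n → Fin n → Fin n → Fin n → Set
Spans5Triangle M x y z = PairwiseAdjacent M x y z × triWeight M x y z ≥ 5

edgeToTri : ∀ {n} → Multigraph n → Fin n → Fin n → Fin n → Fin n → Fin n → ℕ
edgeToTri M a b v₁ v₂ v₃ =
  (μ M a v₁ + μ M b v₁) + (μ M a v₂ + μ M b v₂) + (μ M a v₃ + μ M b v₃)

module Submission where

-- A vertex v is rich for a heavy edge ab when μ(a,v) + μ(b,v) ≥ 3; then a, b, v span a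
-- 5-triangle.  Since M is standard, each corner v of T contributes at most 4 to ‖ab,T‖.
-- Hence ‖e₂,T‖ ≥ 7 > 2+2+2 forces some corner rich for e₂, and ‖e₁,T‖ ≥ 9 > 4+2+2 forces
-- every corner but one to be rich for e₁, in particular one other than the corner chosen
-- for e₂.  The two triangles {a₁,b₁,v} and {a₂,b₂,v′} are then disjoint.

open import Defs
open import Data.Nat using (ℕ; _≥_; _≤_; _<_; _+_; _<?_; s≤s; z≤n)
open import Data.Nat.Properties
  using (+-mono-≤; +-comm; +-assoc; +-identityʳ; +-cancelˡ-<; ≤-<-trans; ≮⇒≥; <⇒≱)
open import Data.Fin using (Fin; zero; suc; _≟_)
open import Data.Fin.Patterns using (0F; 1F; 2F)
open import Data.Fin.Properties using (any?)
open import Data.List using (List; []; _∷_; length; lookup)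
open import Data.List.Membership.Propositional using (_∈_)
open import Data.List.Membership.Propositional.Properties using (∈-lookup)
open import Data.List.Relation.Unary.All using (All; []; _∷_)
import Data.List.Relation.Unary.All as All
open import Data.List.Relation.Unary.Any using (here; there)
open import Data.List.Relation.Unary.AllPairs using ([]; _∷_)
open import Data.List.Relation.Unary.Unique.Propositional using (Unique)
open import Data.Product using (_×_; ∃-syntax; _,_)
open import Data.Empty using (⊥-elim)
open import Relation.Nullary using (yes; no; ¬?; _×-dec_; contradiction)
open import Relation.Binary.PropositionalEquality
  using (_≡_; _≢_; refl; sym; trans; cong; subst; ≢-sym)

m≤k<m+n⇒0<n : ∀ {m n k} → m ≤ k → k < m + n → 0 < n
m≤k<m+n⇒0<n {m} {n} m≤k k<m+n =
  +-cancelˡ-< m 0 n (subst (_< m + n) (sym (+-identityʳ m)) (≤-<-trans m≤k k<m+n))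

Σ₃ : (Fin 3 → ℕ) → ℕ
Σ₃ f = f 0F + f 1F + f 2F

Σ₃-mono : ∀ (f : Fin 3 → ℕ) {p q r} → f 0F ≤ p → f 1F ≤ q → f 2F ≤ r → Σ₃ f ≤ p + q + r
Σ₃-mono f f₀≤p f₁≤q f₂≤r = +-mono-≤ (+-mono-≤ f₀≤p f₁≤q) f₂≤r

Σ₃-≤-except : ∀ (f : Fin 3 → ℕ) {c k} j → f j ≤ c → (∀ i → i ≢ j → f i ≤ k) → Σ₃ f ≤ c + k + k
Σ₃-≤-except f 0F f₀≤c small = Σ₃-mono f f₀≤c (small 1F λ ()) (small 2F λ ())
Σ₃-≤-except f {c} {k} 1F f₁≤c small =
  subst (Σ₃ f ≤_) (cong (_+ k) (+-comm k c)) (Σ₃-mono f (small 0F λ ()) f₁≤c (small 2F λ ()))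
Σ₃-≤-except f {c} {k} 2F f₂≤c small =
  subst (Σ₃ f ≤_) (trans (+-comm (k + k) c) (sym (+-assoc c k k)))
        (Σ₃-mono f (small 0F λ ()) (small 1F λ ()) f₂≤c)

pigeonhole₃ : ∀ k (f : Fin 3 → ℕ) → k + k + k < Σ₃ f → ∃[ i ] k < f i
pigeonhole₃ k f 3k<Σ with any? (λ i → k <? f i)
... | yes found = found
... | no none = contradiction (Σ₃-mono f (small 0F) (small 1F) (small 2F)) (<⇒≱ 3k<Σ)
  where
    small : ∀ i → f i ≤ k
    small i = ≮⇒≥ (λ k<fᵢ → none (i , k<fᵢ))

pigeonhole-avoiding₃ : ∀ c k (f : Fin 3 → ℕ) → (∀ i → f i ≤ c) → c + k + k < Σ₃ f →
                       ∀ j → ∃[ i ] i ≢ j × k < f i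
pigeonhole-avoiding₃ c k f f≤c c+2k<Σ j with any? (λ i → ¬? (i ≟ j) ×-dec k <? f i)
... | yes found = found
... | no none = contradiction (Σ₃-≤-except f j (f≤c j) small) (<⇒≱ c+2k<Σ)
  where
    small : ∀ i → i ≢ j → f i ≤ k
    small i i≢j = ≮⇒≥ (λ k<fᵢ → none (i , i≢j , k<fᵢ))

lookup-injective : ∀ {A : Set} {xs : List A} {i j : Fin (length xs)} →
                   Unique xs → lookup xs i ≡ lookup xs j → i ≡ j
lookup-injective {xs = _ ∷ _} {zero}  {zero}  _            _  = refl
lookup-injective {xs = _ ∷ _} {zero}  {suc j} (x∉xs ∷ _)   eq = ⊥-elim (All.lookup x∉xs (∈-lookup j) eq)
lookup-injective {xs = _ ∷ _} {suc i} {zero}  (x∉xs ∷ _)   eq = ⊥-elim (All.lookup x∉xs (∈-lookup i) (sym eq))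
lookup-injective {xs = _ ∷ _} {suc i} {suc j} (_ ∷ unique) eq = cong suc (lookup-injective unique eq)

module _ {A : Set} {a₁ b₁ a₂ b₂ : A} {vs : List A} {i j : Fin (length vs)} where

  insert-lookups-⊆ : All (_∈ a₁ ∷ b₁ ∷ a₂ ∷ b₂ ∷ vs)
                         (a₁ ∷ b₁ ∷ lookup vs i ∷ a₂ ∷ b₂ ∷ lookup vs j ∷ [])
  insert-lookups-⊆ =
    here refl ∷ there (here refl) ∷ there (there (there (there (∈-lookup i)))) ∷
    there (there (here refl)) ∷ there (there (there (here refl))) ∷
    there (there (there (there (∈-lookup j)))) ∷ []

  Unique-insert-lookups : Unique (a₁ ∷ b₁ ∷ a₂ ∷ b₂ ∷ vs) → i ≢ j →
                          Unique (a₁ ∷ b₁ ∷ lookup vs i ∷ a₂ ∷ b₂ ∷ lookup vs j ∷ [])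
  Unique-insert-lookups
    ((a₁≢b₁ ∷ a₁≢a₂ ∷ a₁≢b₂ ∷ a₁∉vs) ∷ (b₁≢a₂ ∷ b₁≢b₂ ∷ b₁∉vs) ∷
     (a₂≢b₂ ∷ a₂∉vs) ∷ b₂∉vs ∷ vs-unique) i≢j =
    (a₁≢b₁ ∷ apart a₁∉vs i ∷ a₁≢a₂ ∷ a₁≢b₂ ∷ apart a₁∉vs j ∷ []) ∷
    (apart b₁∉vs i ∷ b₁≢a₂ ∷ b₁≢b₂ ∷ apart b₁∉vs j ∷ []) ∷
    (≢-sym (apart a₂∉vs i) ∷ ≢-sym (apart b₂∉vs i) ∷
     (λ eq → i≢j (lookup-injective vs-unique eq)) ∷ []) ∷
    (a₂≢b₂ ∷ apart a₂∉vs j ∷ []) ∷ (apart b₂∉vs j ∷ []) ∷ [] ∷ []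
    where
      apart : ∀ {x} → All (x ≢_) vs → ∀ k → x ≢ lookup vs k
      apart x∉vs k = All.lookup x∉vs (∈-lookup k)

edgeToVertex : ∀ {n} → Multigraph n → Fin n → Fin n → Fin n → ℕ
edgeToVertex M a b v = μ M a v + μ M b v

module _ {n} (M : Multigraph n) (standard : Standard M) where

  edgeToVertex≤4 : ∀ a b v → edgeToVertex M a b v ≤ 4
  edgeToVertex≤4 a b v = +-mono-≤ (standard a v) (standard b v)

  heavy⇒spans5Triangle : ∀ {a b v} → Heavy M a b → 2 < edgeToVertex M a b v →
                         Spans5Triangle M a b v
  heavy⇒spans5Triangle {a} {b} {v} heavy rich =
    (subst (1 ≤_) (sym heavy) (s≤s z≤n) ,
     m≤k<m+n⇒0<n (standard a v) rich , m≤k<m+n⇒0<n (standard b v) rich′) ,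
    subst (λ w → 5 ≤ w + μ M b v + μ M a v) (sym heavy) (s≤s (s≤s rich′))
    where
      rich′ : 2 < μ M b v + μ M a v
      rich′ = subst (2 <_) (+-comm (μ M a v) (μ M b v)) rich

proposition15 : ∀ {n} (M : Multigraph n) → Standard M →
    (v₁ v₂ v₃ a₁ b₁ a₂ b₂ : Fin n) →
    Is5Triangle M v₁ v₂ v₃ →
    Heavy M a₁ b₁ → Heavy M a₂ b₂ →
    Unique (a₁ ∷ b₁ ∷ a₂ ∷ b₂ ∷ v₁ ∷ v₂ ∷ v₃ ∷ []) →
    edgeToTri M a₁ b₁ v₁ v₂ v₃ ≥ 9 →
    edgeToTri M a₂ b₂ v₁ v₂ v₃ ≥ 7 →
    ∃[ x₁ ] ∃[ x₂ ] ∃[ x₃ ] ∃[ y₁ ] ∃[ y₂ ] ∃[ y₃ ]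
      (All (_∈ (a₁ ∷ b₁ ∷ a₂ ∷ b₂ ∷ v₁ ∷ v₂ ∷ v₃ ∷ [])) (x₁ ∷ x₂ ∷ x₃ ∷ y₁ ∷ y₂ ∷ y₃ ∷ [])
       × Unique (x₁ ∷ x₂ ∷ x₃ ∷ y₁ ∷ y₂ ∷ y₃ ∷ [])
       × Spans5Triangle M x₁ x₂ x₃
       × Spans5Triangle M y₁ y₂ y₃)
-- Only the distinctness of v₁, v₂, v₃ matters.
proposition15 {n} M standard v₁ v₂ v₃ a₁ b₁ a₂ b₂ _ heavy₁ heavy₂ unique ‖e₁,T‖≥9 ‖e₂,T‖≥7 =
  let j , rich₂ = pigeonhole₃ 2 (edgeToCorner a₂ b₂) ‖e₂,T‖≥7
      i , i≢j , rich₁ = pigeonhole-avoiding₃ 4 2 (edgeToCorner a₁ b₁)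
                          (λ k → edgeToVertex≤4 M standard a₁ b₁ (corner k)) ‖e₁,T‖≥9 j
  in a₁ , b₁ , corner i , a₂ , b₂ , corner j ,
     insert-lookups-⊆ {i = i} {j} , Unique-insert-lookups unique i≢j ,
     heavy⇒spans5Triangle M standard heavy₁ rich₁ ,
     heavy⇒spans5Triangle M standard heavy₂ rich₂
  where
    corner : Fin 3 → Fin n
    corner = lookup (v₁ ∷ v₂ ∷ v₃ ∷ [])

    edgeToCorner : Fin n → Fin n → Fin 3 → ℕ
    edgeToCorner a b k = edgeToVertex M a b (corner k)
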